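{- Let $\sigma$ be a D-permutation of $[2n]$, let $F'=\{i:\sigma^{ -1}(i)\text{ even}\}$, $G=\{1,3,\dots,2n-1\}$, $G'=\{i:\sigma^{ -1}(i)\text{ odd}\}$, and let $y$ be odd with $y\in G\cap F'$ (i.e. $y$ is a cycle valley of $\sigma$). Then \[ \#\{u\in G'\setminus\{\sigma(2n-1),\sigma(2n-3),\dots,\sigma(y+2)\}:u>y\}=\lceil h_{y-1}/2\rceil+1=\lceil (h_y+1)/2\rceil=f_y, \] where $h_i$ is the height after step $i$ of the almost-Dyck path of $\sigma$ and $f_k=\#\{i\le k:\sigma(i)>k\}$.
   Context: A D-permutation of $[2n]$ is a permutation $\sigma$ with $\sigma(2k-1)\ge2k-1$ and $\sigma(2k)\le2k$ for all $k$. The almost-Dyck path of $\sigma$ has steps $s_1,\dots,s_{2n}$ starting at height $h_0=0$: $s_i$ is a rise (height $+1$) if $\sigma^{ -1}(i)$ is even and a fall (height $-1$) if $\sigma^{ -1}(i)$ is odd; $h_i$ is the height after step $i$. A cycle valley is an index $i$ with $\sigma^{ -1}(i)>i<\sigma(i)$. -}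

module Defs where

open import Data.Nat using (ℕ; zero; suc; _+_; _*_; _∸_; _≤_; _<_; _<?_; _/_)
open import Data.Nat.Properties using (_≟_)
open import Data.Bool using (Bool; true; false; if_then_else_)
open import Data.Fin using (Fin; toℕ; fromℕ<)
open import Data.Fin.Permutation using (Permutation′; _⟨$⟩ʳ_; _⟨$⟩ˡ_)
open import Data.Integer as ℤ using (ℤ; +_; -[1+_])
open import Data.List using (List; []; _∷_; filter; length; map)
open import Data.List.Membership.DecPropositional _≟_ using (_∈?_)
open import Relation.Nullary using (yes; no; ¬?; does)
open import Relation.Nullary.Decidable using (_×-dec_)
open import Relation.Binary.PropositionalEquality using (_≡_)

odd : ℕ → Bool
odd zero    = false
odd (suc m) = if odd m then false else true

even : ℕ → Bool
even m = if odd m then false else true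

Odd : ℕ → Set
Odd m = odd m ≡ true

Even : ℕ → Set
Even m = even m ≡ true

-- Convention: a permutation of [2n] = {1,…,2n} is a bijection Fin (2n) ↔ Fin (2n),
-- where the element k : Fin (2n) represents the integer toℕ k + 1.
-- (wrapped in a record so that n can be inferred from σ)
record Perm (n : ℕ) : Set where
  constructor mkPerm
  field perm : Permutation′ (2 * n)
open Perm public

-- σ as a function on ℕ (1-based); value 0 outside [1,2n] (never used there).
app : ∀ {n} → Perm n → ℕ → ℕ
app {n} σ zero = zero
app {n} σ (suc i) with i <? 2 * n
... | yes p = suc (toℕ (perm σ ⟨$⟩ʳ fromℕ< p))
... | no _  = zero

appInv : ∀ {n} → Perm n → ℕ → ℕ
appInv {n} σ zero = zero
appInv {n} σ (suc i) with i <? 2 * n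
... | yes p = suc (toℕ (perm σ ⟨$⟩ˡ fromℕ< p))
... | no _  = zero

IsDPerm : ∀ {n} → Perm n → Set
IsDPerm {n} σ = ∀ k → 1 ≤ k → k ≤ n →
  (2 * k ∸ 1 ≤ app σ (2 * k ∸ 1)) × (app σ (2 * k) ≤ 2 * k)
  where open import Data.Product using (_×_)

range : ℕ → ℕ → List ℕ
range a b = go (suc b ∸ a) a
  where
  go : ℕ → ℕ → List ℕ
  go zero    _ = []
  go (suc k) x = x ∷ go k (suc x)

step : ∀ {n} → Perm n → ℕ → ℤ
step σ i = if even (appInv σ i) then ℤ.+ 1 else ℤ.- (ℤ.+ 1)

height : ∀ {n} → Perm n → ℕ → ℤ
height σ zero    = ℤ.+ 0
height σ (suc i) = height σ i ℤ.+ step σ (suc i)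

ceilHalf : ℤ → ℤ
ceilHalf (+ m)     = + ((suc m) / 2)
ceilHalf -[1+ m ]  = ℤ.- (+ ((suc m) / 2))

fcount : ∀ {n} → Perm n → ℕ → ℕ
fcount σ k = length (filter (λ i → k <? app σ i) (range 1 k))

excluded : ∀ {n} → Perm n → ℕ → List ℕ
excluded {n} σ y = map (app σ) (filter (λ j → odd j Data.Bool.≟ true) (range (y + 2) (2 * n ∸ 1)))
  where import Data.Bool

leftCount : ∀ {n} → Perm n → ℕ → ℕ
leftCount {n} σ y =
  length (filter (λ u → ((odd (appInv σ u) Data.Bool.≟ true) ×-dec ¬? (u ∈? excluded σ y)) ×-dec (y <? u))
                 (range 1 (2 * n)))
  where import Data.Bool

module Submission where

-- Write J = σ⁻¹(k+1). Comparing the positions i ≤ k+1 with σ(i) > k+1 to those i ≤ k with σ(i) > k gives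
-- f_{k+1} + [J ≤ k] = f_k + [σ(k+1) > k+1]. For a D-permutation odd positions move up and even ones down, so
-- both indicators are fixed by the parities of k+1 and J: at a rise f grows by [k+1 odd], at a fall it drops
-- by [k odd]. Hence h_k + [k odd] = 2 f_k along the whole path. At the odd cycle valley y this gives
-- h_y + 1 = 2 f_y, h_{y-1} = 2 f_{y-1} and, s_y being a rise, f_y = f_{y-1} + 1. Finally σ maps
-- {i ≤ y : σ(i) > y} onto the left-hand set: such an i is odd, since an even i has σ(i) ≤ i ≤ y; conversely an
-- odd σ⁻¹(u) > y lies in {y+2, …, 2n−1}, so u would be excluded.

open import Defs
open import Data.Bool using (Bool; true; false; not; if_then_else_)
open import Data.Bool.Properties as Bool using (not-injective)
open import Data.Fin using (toℕ; fromℕ<)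
open import Data.Fin.Properties using (toℕ<n; fromℕ<-toℕ; toℕ-fromℕ<)
open import Data.Fin.Permutation using (_⟨$⟩ʳ_; _⟨$⟩ˡ_; inverseˡ; inverseʳ)
open import Data.Integer as ℤ using (ℤ; +_; -1ℤ)
import Data.Integer.Properties as ℤ
open import Data.Integer.Tactic.RingSolver using (solve-∀)
open import Data.List using (List; []; _∷_; [_]; _++_; filter; length; map; iterate)
open import Data.List.Properties using (filter-++; length-++; length-map)
open import Data.List.Membership.Propositional using (_∈_; _∉_)
open import Data.List.Membership.Propositional.Properties using (∈-map⁺; ∈-map⁻; ∈-filter⁺; ∈-filter⁻)
open import Data.List.Membership.Propositional.Properties.WithK using (unique∧set⇒bag)
open import Data.List.Relation.Binary.BagAndSetEquality using (∼bag⇒↭)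
open import Data.List.Relation.Binary.Permutation.Propositional.Properties using (↭-length)
import Data.List.Relation.Unary.All as All
import Data.List.Relation.Unary.All.Properties as All
open import Data.List.Relation.Unary.AllPairs using ([]; _∷_)
open import Data.List.Relation.Unary.Any using (here; there)
open import Data.List.Relation.Unary.Unique.Propositional using (Unique)
import Data.List.Relation.Unary.Unique.Propositional.Properties as Unique
open import Data.Nat
open import Data.Nat.Properties
import Data.Nat.Tactic.RingSolver as ℕ-Solver
open import Data.List.Membership.DecPropositional _≟_ using (_∈?_)
open import Algebra.Properties.CommutativeSemigroup +-commutativeSemigroup using (interchange; xy∙z≈xz∙y)
open import Data.Nat.DivMod using (+-distrib-/-∣ʳ; m*n/n≡m)
open import Data.Nat.Divisibility using (divides)
open import Data.Product using (∃-syntax; _×_; _,_; proj₁; proj₂; map₁)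
open import Function.Base using (_∘_)
open import Function.Bundles using (_⇔_; mk⇔; Equivalence)
open import Relation.Binary using (tri<; tri≈; tri>)
open import Relation.Nullary using (¬?; Dec; yes; no; does; contradiction)
open import Relation.Nullary.Decidable using (dec-true; dec-false; does-≡; _×-dec_)
import Relation.Nullary.Decidable as Dec
open import Relation.Unary using (Decidable)
open import Relation.Binary.PropositionalEquality using (_≡_; _≢_; refl; sym; trans; cong; cong₂; subst; module ≡-Reasoning)

bit : Bool → ℕ
bit b = if b then 1 else 0

does-⇔ : ∀ {p q} {P : Set p} {Q : Set q} → P ⇔ Q → (P? : Dec P) (Q? : Dec Q) → does P? ≡ does Q?
does-⇔ P⇔Q P? Q? = does-≡ (Dec.map P⇔Q P?) Q?

odd-suc : ∀ m → odd (suc m) ≡ not (odd m)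
odd-suc m with odd m
... | true  = refl
... | false = refl

odd-suc-suc : ∀ m → odd (suc (suc m)) ≡ odd m
odd-suc-suc m with odd m
... | true  = refl
... | false = refl

odd-double : ∀ k → odd (2 * k) ≡ false
odd-double zero    = refl
odd-double (suc k) = trans (cong odd (*-suc 2 k)) (trans (odd-suc-suc (2 * k)) (odd-double k))

odd≢even : ∀ {a b} → odd a ≡ true → odd b ≡ false → a ≢ b
odd≢even oa eb refl with trans (sym oa) eb
... | ()

odd-suc⁻ : ∀ {m} → odd (suc m) ≡ true → odd m ≡ false
odd-suc⁻ {m} p = not-injective (trans (sym (odd-suc m)) p)

even-suc⁻ : ∀ {m} → odd (suc m) ≡ false → odd m ≡ true
even-suc⁻ {m} p = not-injective (trans (sym (odd-suc m)) p)

bit-odd-suc : ∀ k → bit (odd k) + bit (odd (suc k)) ≡ 1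
bit-odd-suc k rewrite odd-suc k with odd k
... | true  = refl
... | false = refl

odd⇒suc-double : ∀ {m} → odd m ≡ true → ∃[ k ] m ≡ suc (2 * k)
even⇒double : ∀ {m} → odd m ≡ false → ∃[ k ] m ≡ 2 * k
odd⇒suc-double {suc m} p with even⇒double {m} (odd-suc⁻ {m} p)
... | k , refl = k , refl
even⇒double {zero}  p = 0 , refl
even⇒double {suc m} p with odd⇒suc-double {m} (even-suc⁻ {m} p)
... | k , refl = suc k , sym (*-suc 2 k)

Even⇒odd≡false : ∀ {m} → Even m → odd m ≡ false
Even⇒odd≡false {m} p with odd m
... | false = refl

module _ {n : ℕ} (σ : Perm n) where

  app-bounded : ∀ {i} → 1 ≤ i → i ≤ 2 * n → 1 ≤ app σ i × app σ i ≤ 2 * n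
  app-bounded {suc i} _ i≤2n with i <? 2 * n
  ... | yes _     = s≤s z≤n , toℕ<n _
  ... | no  i≮2n = contradiction i≤2n i≮2n

  appInv-bounded : ∀ {i} → 1 ≤ i → i ≤ 2 * n → 1 ≤ appInv σ i × appInv σ i ≤ 2 * n
  appInv-bounded {suc i} _ i≤2n with i <? 2 * n
  ... | yes _     = s≤s z≤n , toℕ<n _
  ... | no  i≮2n = contradiction i≤2n i≮2n

  appInv-app : ∀ {i} → 1 ≤ i → i ≤ 2 * n → appInv σ (app σ i) ≡ i
  appInv-app {suc i} _ i≤2n with i <? 2 * n
  ... | no  i≮2n = contradiction i≤2n i≮2n
  ... | yes i<2n with toℕ (perm σ ⟨$⟩ʳ fromℕ< i<2n) <? 2 * n
  ...   | no  j≮2n = contradiction (toℕ<n _) j≮2n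
  ...   | yes j<2n = cong suc (begin
    toℕ (perm σ ⟨$⟩ˡ fromℕ< j<2n)               ≡⟨ cong (λ j → toℕ (perm σ ⟨$⟩ˡ j)) (fromℕ<-toℕ _ j<2n) ⟩
    toℕ (perm σ ⟨$⟩ˡ (perm σ ⟨$⟩ʳ fromℕ< i<2n)) ≡⟨ cong toℕ (inverseˡ (perm σ)) ⟩
    toℕ (fromℕ< i<2n)                            ≡⟨ toℕ-fromℕ< i<2n ⟩
    i                                            ∎)
    where open ≡-Reasoning

  app-appInv : ∀ {i} → 1 ≤ i → i ≤ 2 * n → app σ (appInv σ i) ≡ i
  app-appInv {suc i} _ i≤2n with i <? 2 * n
  ... | no  i≮2n = contradiction i≤2n i≮2n
  ... | yes i<2n with toℕ (perm σ ⟨$⟩ˡ fromℕ< i<2n) <? 2 * n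
  ...   | no  j≮2n = contradiction (toℕ<n _) j≮2n
  ...   | yes j<2n = cong suc (begin
    toℕ (perm σ ⟨$⟩ʳ fromℕ< j<2n)               ≡⟨ cong (λ j → toℕ (perm σ ⟨$⟩ʳ j)) (fromℕ<-toℕ _ j<2n) ⟩
    toℕ (perm σ ⟨$⟩ʳ (perm σ ⟨$⟩ˡ fromℕ< i<2n)) ≡⟨ cong toℕ (inverseʳ (perm σ)) ⟩
    toℕ (fromℕ< i<2n)                            ≡⟨ toℕ-fromℕ< i<2n ⟩
    i                                            ∎)
    where open ≡-Reasoning

  app-injective : ∀ {i j} → 1 ≤ i → i ≤ 2 * n → 1 ≤ j → j ≤ 2 * n → app σ i ≡ app σ j → i ≡ j
  app-injective 1≤i i≤2n 1≤j j≤2n eq =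
    trans (sym (appInv-app 1≤i i≤2n)) (trans (cong (appInv σ) eq) (appInv-app 1≤j j≤2n))

  app≡⇔appInv≡ : ∀ {i v} → 1 ≤ i → i ≤ 2 * n → 1 ≤ v → v ≤ 2 * n → (app σ i ≡ v) ⇔ (appInv σ v ≡ i)
  app≡⇔appInv≡ 1≤i i≤2n 1≤v v≤2n = mk⇔
    (λ { refl → appInv-app 1≤i i≤2n })
    (λ { refl → app-appInv 1≤v v≤2n })

module _ {n : ℕ} {σ : Perm n} (dperm : IsDPerm σ) where

  odd⇒≤app : ∀ {i} → i ≤ 2 * n → odd i ≡ true → i ≤ app σ i
  odd⇒≤app {i} i≤2n oddi with odd⇒suc-double {i} oddi
  ... | k , refl = subst (λ j → j ≤ app σ j) (cong (_∸ 1) (*-suc 2 k)) (proj₁ (dperm (suc k) (s≤s z≤n) k<n))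
    where
    k<n : k < n
    k<n = *-cancelˡ-< 2 k n i≤2n

  even⇒app≤ : ∀ {i} → 1 ≤ i → i ≤ 2 * n → odd i ≡ false → app σ i ≤ i
  even⇒app≤ {i} 1≤i i≤2n eveni with even⇒double {i} eveni
  even⇒app≤ () _ _ | zero , refl
  ... | suc k , refl = proj₂ (dperm (suc k) (s≤s z≤n) (*-cancelˡ-≤ 2 i≤2n))

  <app⇒odd : ∀ {i} → 1 ≤ i → i ≤ 2 * n → i < app σ i → odd i ≡ true
  <app⇒odd {i} 1≤i i≤2n i<σi with odd i in odd-i
  ... | true  = refl
  ... | false = contradiction i<σi (≤⇒≯ (even⇒app≤ 1≤i i≤2n odd-i))

<⇒≤∸1 : ∀ {j m} → j < m → j ≤ m ∸ 1
<⇒≤∸1 {m = suc m} (s≤s j≤m) = j≤m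

∸-suc-injective : ∀ a b c → suc b ∸ a ≡ suc c → b ∸ a ≡ c
∸-suc-injective zero          b       c refl = refl
∸-suc-injective (suc zero)    zero    c ()
∸-suc-injective (suc (suc a)) zero    c ()
∸-suc-injective (suc a)       (suc b) c eq   = ∸-suc-injective a b c eq

-- The helper in the definition of range is local; abstracting its counter suc b ∸ a exposes its recursion.
range≡iterate : ∀ a b → range a b ≡ iterate suc a (suc b ∸ a)
range≡iterate a b = go (suc b ∸ a) a b refl
  where
  go : ∀ c a b → suc b ∸ a ≡ c → range a b ≡ iterate suc a c
  go c a b eq with suc b ∸ a in eq′
  go zero    a b refl | zero  = refl
  go (suc c) a b refl | suc c rewrite sym (∸-suc-injective a b c eq′) = cong (a ∷_) (go (b ∸ a) (suc a) b refl)

∈-iterate-suc : ∀ {x z} c → z ∈ iterate suc x c ⇔ (x ≤ z × z < x + c)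
∈-iterate-suc c = mk⇔ (to c) (from c)
  where
  to : ∀ {x z} c → z ∈ iterate suc x c → x ≤ z × z < x + c
  to {x} (suc c) (here refl) = ≤-refl , m<m+n x z<s
  to {x} {z} (suc c) (there z∈) with to c z∈
  ... | x<z , z<x+1+c = <⇒≤ x<z , subst (z <_) (sym (+-suc x c)) z<x+1+c
  from : ∀ {x z} c → x ≤ z × z < x + c → z ∈ iterate suc x c
  from {x} {z} zero    (x≤z , z<x+0) = contradiction (subst (z <_) (+-identityʳ x) z<x+0) (≤⇒≯ x≤z)
  from {x} {z} (suc c) (x≤z , z<x+1+c) with x ≟ z
  ... | yes refl = here refl
  ... | no  x≢z  = there (from c (≤∧≢⇒< x≤z x≢z , subst (z <_) (+-suc x c) z<x+1+c))

iterate-suc-unique : ∀ x c → Unique (iterate suc x c)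
iterate-suc-unique x zero    = []
iterate-suc-unique x (suc c) =
  All.tabulate (λ z∈ → <⇒≢ (proj₁ (Equivalence.to (∈-iterate-suc c) z∈))) ∷ iterate-suc-unique (suc x) c

iterate-suc-snoc : ∀ x c → iterate suc x (suc c) ≡ iterate suc x c ++ [ x + c ]
iterate-suc-snoc x zero    = cong [_] (sym (+-identityʳ x))
iterate-suc-snoc x (suc c) = cong (x ∷_) (trans (iterate-suc-snoc (suc x) c)
                                                 (cong (λ z → iterate suc (suc x) c ++ [ z ]) (sym (+-suc x c))))

∈-range : ∀ {a b z} → z ∈ range a b ⇔ (a ≤ z × z ≤ b)
∈-range {a} {b} {z} = mk⇔ to from
  where
  to : z ∈ range a b → a ≤ z × z ≤ b
  to z∈ with Equivalence.to (∈-iterate-suc (suc b ∸ a)) (subst (z ∈_) (range≡iterate a b) z∈)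
  ... | a≤z , z<a+[1+b∸a] with a ≤? suc b
  ...   | yes a≤1+b = a≤z , ≤-pred (subst (z <_) (m+[n∸m]≡n a≤1+b) z<a+[1+b∸a])
  ...   | no  a≰1+b = contradiction (subst (z <_) a+[1+b∸a]≡a z<a+[1+b∸a]) (≤⇒≯ a≤z)
    where
    a+[1+b∸a]≡a : a + (suc b ∸ a) ≡ a
    a+[1+b∸a]≡a = trans (cong (λ t → a + t) (m≤n⇒m∸n≡0 (<⇒≤ (≰⇒> a≰1+b)))) (+-identityʳ a)
  from : a ≤ z × z ≤ b → z ∈ range a b
  from (a≤z , z≤b) = subst (z ∈_) (sym (range≡iterate a b))
    (Equivalence.from (∈-iterate-suc (suc b ∸ a)) (a≤z , subst (z <_) (sym (m+[n∸m]≡n a≤1+b)) (s≤s z≤b)))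
    where
    a≤1+b : a ≤ suc b
    a≤1+b = ≤-trans a≤z (≤-trans z≤b (n≤1+n b))

range-unique : ∀ a b → Unique (range a b)
range-unique a b = subst Unique (sym (range≡iterate a b)) (iterate-suc-unique a (suc b ∸ a))

range-snoc : ∀ k → range 1 (suc k) ≡ range 1 k ++ [ suc k ]
range-snoc k = trans (range≡iterate 1 (suc k))
  (trans (iterate-suc-snoc 1 k) (cong (_++ [ suc k ]) (sym (range≡iterate 1 k))))

module _ {a p} {A : Set a} {P : A → Set p} (P? : Decidable P) where

  length-filter-∷ : ∀ x xs → length (filter P? (x ∷ xs)) ≡ bit (does (P? x)) + length (filter P? xs)
  length-filter-∷ x xs with does (P? x)
  ... | true  = refl
  ... | false = refl

  length-filter-snoc : ∀ xs x → length (filter P? (xs ++ [ x ])) ≡ length (filter P? xs) + bit (does (P? x))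
  length-filter-snoc xs x = begin
    length (filter P? (xs ++ [ x ]))                     ≡⟨ cong length (filter-++ P? xs [ x ]) ⟩
    length (filter P? xs ++ filter P? [ x ])             ≡⟨ length-++ (filter P? xs) ⟩
    length (filter P? xs) + length (filter P? [ x ])     ≡⟨ cong (_+_ (length (filter P? xs))) (length-filter-∷ x []) ⟩
    length (filter P? xs) + (bit (does (P? x)) + 0)      ≡⟨ cong (_+_ (length (filter P? xs))) (+-identityʳ _) ⟩
    length (filter P? xs) + bit (does (P? x))            ∎
    where open ≡-Reasoning

length-filter-range-suc : ∀ {p} {P : ℕ → Set p} (P? : Decidable P) k →
  length (filter P? (range 1 (suc k))) ≡ length (filter P? (range 1 k)) + bit (does (P? (suc k)))
length-filter-range-suc P? k =
  trans (cong (λ xs → length (filter P? xs)) (range-snoc k)) (length-filter-snoc P? (range 1 k) (suc k))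

length-filter-split : ∀ {a p q r} {A : Set a} {P : A → Set p} {Q : A → Set q} {R : A → Set r}
  (P? : Decidable P) (Q? : Decidable Q) (R? : Decidable R) →
  (∀ x → bit (does (P? x)) ≡ bit (does (Q? x)) + bit (does (R? x))) →
  ∀ xs → length (filter P? xs) ≡ length (filter Q? xs) + length (filter R? xs)
length-filter-split P? Q? R? split []       = refl
length-filter-split P? Q? R? split (x ∷ xs) = begin
  length (filter P? (x ∷ xs))                                ≡⟨ length-filter-∷ P? x xs ⟩
  bit (does (P? x)) + length (filter P? xs)                  ≡⟨ cong₂ _+_ (split x) (length-filter-split P? Q? R? split xs) ⟩
  (qx + rx) + (qs + rs)                                      ≡⟨ interchange qx rx qs rs ⟩
  (qx + qs) + (rx + rs)                                      ≡⟨ sym (cong₂ _+_ (length-filter-∷ Q? x xs) (length-filter-∷ R? x xs)) ⟩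
  length (filter Q? (x ∷ xs)) + length (filter R? (x ∷ xs))  ∎
  where
  open ≡-Reasoning
  qx = bit (does (Q? x))
  rx = bit (does (R? x))
  qs = length (filter Q? xs)
  rs = length (filter R? xs)

bit-<-split : ∀ k m → bit (does (k <? m)) ≡ bit (does (suc k <? m)) + bit (does (m ≟ suc k))
bit-<-split k m with <-cmp (suc k) m
... | tri< 1+k<m _ _
  rewrite dec-true (k <? m) (<-trans (n<1+n k) 1+k<m) | dec-true (suc k <? m) 1+k<m
        | dec-false (m ≟ suc k) (<⇒≢ 1+k<m ∘ sym) = refl
... | tri≈ _ refl _
  rewrite dec-true (k <? m) (n<1+n k) | dec-false (suc k <? m) (n≮n m) | dec-true (m ≟ suc k) refl = refl
... | tri> _ 1+k≢m 1+k>m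
  rewrite dec-false (k <? m) (≤⇒≯ (≤-pred 1+k>m)) | dec-false (suc k <? m) (<⇒≯ 1+k>m)
        | dec-false (m ≟ suc k) (1+k≢m ∘ sym) = refl

bit-≤-split : ∀ j m → bit (does (j ≤? suc m)) ≡ bit (does (j ≤? m)) + bit (does (j ≟ suc m))
bit-≤-split j m with <-cmp j (suc m)
... | tri< j<1+m j≢1+m _
  rewrite dec-true (j ≤? suc m) (<⇒≤ j<1+m) | dec-true (j ≤? m) (≤-pred j<1+m)
        | dec-false (j ≟ suc m) j≢1+m = refl
... | tri≈ _ refl _
  rewrite dec-true (j ≤? suc m) ≤-refl | dec-false (j ≤? m) (n≮n m) | dec-true (j ≟ suc m) refl = refl
... | tri> _ j≢1+m j>1+m
  rewrite dec-false (j ≤? suc m) (<⇒≱ j>1+m) | dec-false (j ≤? m) (<⇒≱ (<-trans (n<1+n m) j>1+m))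
        | dec-false (j ≟ suc m) j≢1+m = refl

count-exceeding-suc : ∀ (g : ℕ → ℕ) k →
  length (filter (λ i → suc k <? g i) (range 1 (suc k))) + length (filter (λ i → g i ≟ suc k) (range 1 k))
  ≡ length (filter (λ i → k <? g i) (range 1 k)) + bit (does (suc k <? g (suc k)))
count-exceeding-suc g k = begin
  length (filter (λ i → suc k <? g i) (range 1 (suc k))) + C
    ≡⟨ cong (_+ C) (length-filter-range-suc (λ i → suc k <? g i) k) ⟩
  A + b + C
    ≡⟨ xy∙z≈xz∙y A b C ⟩
  A + C + b
    ≡⟨ cong (_+ b) (sym (length-filter-split _ _ _ (λ i → bit-<-split k (g i)) (range 1 k))) ⟩
  length (filter (λ i → k <? g i) (range 1 k)) + b ∎
  where
  open ≡-Reasoning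
  A = length (filter (λ i → suc k <? g i) (range 1 k))
  b = bit (does (suc k <? g (suc k)))
  C = length (filter (λ i → g i ≟ suc k) (range 1 k))

module _ {n : ℕ} (σ : Perm n) where

  preimage-count : ∀ {v} m → 1 ≤ v → v ≤ 2 * n → m ≤ 2 * n →
    length (filter (λ i → app σ i ≟ v) (range 1 m)) ≡ bit (does (appInv σ v ≤? m))
  preimage-count {v} zero 1≤v v≤2n _
    rewrite dec-false (appInv σ v ≤? 0) (<⇒≱ (proj₁ (appInv-bounded σ 1≤v v≤2n))) = refl
  preimage-count {v} (suc m) 1≤v v≤2n 1+m≤2n = begin
    length (filter (λ i → app σ i ≟ v) (range 1 (suc m)))
      ≡⟨ length-filter-range-suc (λ i → app σ i ≟ v) m ⟩
    length (filter (λ i → app σ i ≟ v) (range 1 m)) + bit (does (app σ (suc m) ≟ v))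
      ≡⟨ cong₂ _+_ (preimage-count m 1≤v v≤2n (<⇒≤ 1+m≤2n)) (cong bit hit⇔preimage) ⟩
    bit (does (appInv σ v ≤? m)) + bit (does (appInv σ v ≟ suc m))
      ≡⟨ sym (bit-≤-split (appInv σ v) m) ⟩
    bit (does (appInv σ v ≤? suc m)) ∎
    where
    open ≡-Reasoning
    hit⇔preimage : does (app σ (suc m) ≟ v) ≡ does (appInv σ v ≟ suc m)
    hit⇔preimage = does-⇔ (app≡⇔appInv≡ σ (s≤s z≤n) 1+m≤2n 1≤v v≤2n) (app σ (suc m) ≟ v) (appInv σ v ≟ suc m)

  fcount-suc : ∀ {k} → suc k ≤ 2 * n →
    fcount σ (suc k) + bit (does (appInv σ (suc k) ≤? k)) ≡ fcount σ k + bit (does (suc k <? app σ (suc k)))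
  fcount-suc {k} 1+k≤2n =
    trans (cong (_+_ (fcount σ (suc k))) (sym (preimage-count k (s≤s z≤n) 1+k≤2n (<⇒≤ 1+k≤2n))))
          (count-exceeding-suc (app σ) k)

module _ {n : ℕ} {σ : Perm n} (dperm : IsDPerm σ) {k : ℕ} (1+k≤2n : suc k ≤ 2 * n) where

  -- An arrival is J ≤ k and a departure is k + 1 < σ(k + 1): the two corrections in fcount-suc.
  private
    J = appInv σ (suc k)
    1≤J = proj₁ (appInv-bounded σ (s≤s z≤n) 1+k≤2n)
    J≤2n = proj₂ (appInv-bounded σ (s≤s z≤n) 1+k≤2n)

    fixed⇔ : (app σ (suc k) ≡ suc k) ⇔ (J ≡ suc k)
    fixed⇔ = app≡⇔appInv≡ σ (s≤s z≤n) 1+k≤2n (s≤s z≤n) 1+k≤2n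

    odd⇒J≤1+k : odd J ≡ true → J ≤ suc k
    odd⇒J≤1+k oddJ = subst (J ≤_) (app-appInv σ (s≤s z≤n) 1+k≤2n) (odd⇒≤app dperm J≤2n oddJ)

  fcount-rise : odd (appInv σ (suc k)) ≡ false → fcount σ (suc k) ≡ fcount σ k + bit (odd (suc k))
  fcount-rise evenJ = begin
    fcount σ (suc k)                                       ≡⟨ sym (+-identityʳ _) ⟩
    fcount σ (suc k) + bit false                           ≡⟨ cong (λ b → fcount σ (suc k) + bit b) (sym no-arrival) ⟩
    fcount σ (suc k) + bit (does (J ≤? k))                 ≡⟨ fcount-suc σ 1+k≤2n ⟩
    fcount σ k + bit (does (suc k <? app σ (suc k)))       ≡⟨ cong (λ b → fcount σ k + bit b) departure ⟩
    fcount σ k + bit (odd (suc k))                         ∎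
    where
    open ≡-Reasoning
    1+k≤J : suc k ≤ J
    1+k≤J = subst (_≤ J) (app-appInv σ (s≤s z≤n) 1+k≤2n) (even⇒app≤ dperm 1≤J J≤2n evenJ)
    no-arrival : does (J ≤? k) ≡ false
    no-arrival = dec-false (J ≤? k) (λ J≤k → ≤⇒≯ J≤k 1+k≤J)
    departure : does (suc k <? app σ (suc k)) ≡ odd (suc k)
    departure with odd (suc k) in odd-i
    ... | true  = dec-true (suc k <? app σ (suc k))
                    (≤∧≢⇒< (odd⇒≤app dperm 1+k≤2n odd-i)
                           (λ fixed → odd≢even odd-i evenJ (sym (Equivalence.to fixed⇔ (sym fixed)))))
    ... | false = dec-false (suc k <? app σ (suc k)) (≤⇒≯ (even⇒app≤ dperm (s≤s z≤n) 1+k≤2n odd-i))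

  fcount-fall : odd (appInv σ (suc k)) ≡ true → fcount σ (suc k) + bit (odd k) ≡ fcount σ k
  fcount-fall oddJ with odd k in odd-k
  ... | true  = begin
    fcount σ (suc k) + bit true                            ≡⟨ cong (λ b → fcount σ (suc k) + bit b) (sym arrival) ⟩
    fcount σ (suc k) + bit (does (J ≤? k))                 ≡⟨ fcount-suc σ 1+k≤2n ⟩
    fcount σ k + bit (does (suc k <? app σ (suc k)))       ≡⟨ cong (λ b → fcount σ k + bit b) no-departure ⟩
    fcount σ k + 0                                         ≡⟨ +-identityʳ _ ⟩
    fcount σ k                                             ∎
    where
    open ≡-Reasoning
    even-i : odd (suc k) ≡ false
    even-i = trans (odd-suc k) (cong not odd-k)
    arrival : does (J ≤? k) ≡ true
    arrival = dec-true (J ≤? k) (≤-pred (≤∧≢⇒< (odd⇒J≤1+k oddJ) (odd≢even oddJ even-i)))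
    no-departure : does (suc k <? app σ (suc k)) ≡ false
    no-departure = dec-false (suc k <? app σ (suc k)) (≤⇒≯ (even⇒app≤ dperm (s≤s z≤n) 1+k≤2n even-i))
  ... | false = trans (+-identityʳ _) (+-cancelʳ-≡ _ _ _ same-crossings)
    where
    odd-i : odd (suc k) ≡ true
    odd-i = trans (odd-suc k) (cong not odd-k)
    arrival⇔departure : does (J ≤? k) ≡ does (suc k <? app σ (suc k))
    arrival⇔departure = does-⇔ (mk⇔
      (λ J≤k → ≤∧≢⇒< (odd⇒≤app dperm 1+k≤2n odd-i)
                     (λ fixed → <⇒≢ (s≤s J≤k) (Equivalence.to fixed⇔ (sym fixed))))
      (λ i<σi → ≤-pred (≤∧≢⇒< (odd⇒J≤1+k oddJ)
                     (λ J≡i → <⇒≢ i<σi (sym (Equivalence.from fixed⇔ J≡i))))))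
      (J ≤? k) (suc k <? app σ (suc k))
    same-crossings : fcount σ (suc k) + bit (does (J ≤? k)) ≡ fcount σ k + bit (does (J ≤? k))
    same-crossings = trans (fcount-suc σ 1+k≤2n) (cong (λ b → fcount σ k + bit b) (sym arrival⇔departure))

-- a and b stand for the parity bits of k and k + 1.
module _ (h : ℤ) {a b m : ℕ} (a+b≡1 : a + b ≡ 1) where

  rise-invariant : h ℤ.+ + a ≡ + (2 * m) → h ℤ.+ + 1 ℤ.+ + b ≡ + (2 * (m + b))
  rise-invariant ih = begin
    h ℤ.+ + 1 ℤ.+ + b                  ≡⟨ cong (λ t → h ℤ.+ + t ℤ.+ + b) (sym a+b≡1) ⟩
    h ℤ.+ (+ a ℤ.+ + b) ℤ.+ + b        ≡⟨ shuffle h (+ a) (+ b) ⟩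
    (h ℤ.+ + a) ℤ.+ (+ b ℤ.+ + b)      ≡⟨ cong (ℤ._+ (+ b ℤ.+ + b)) ih ⟩
    + (2 * m + (b + b))                ≡⟨ cong +_ (double-+ m b) ⟩
    + (2 * (m + b))                    ∎
    where
    open ≡-Reasoning
    shuffle : ∀ (x y z : ℤ) → x ℤ.+ (y ℤ.+ z) ℤ.+ z ≡ (x ℤ.+ y) ℤ.+ (z ℤ.+ z)
    shuffle = solve-∀
    double-+ : ∀ m b → 2 * m + (b + b) ≡ 2 * (m + b)
    double-+ = ℕ-Solver.solve-∀

  fall-invariant : h ℤ.+ + a ≡ + (2 * (m + a)) → h ℤ.+ -1ℤ ℤ.+ + b ≡ + (2 * m)
  fall-invariant ih = begin
    h ℤ.+ -1ℤ ℤ.+ + b                                  ≡⟨ cong (λ t → h ℤ.- + t ℤ.+ + b) (sym a+b≡1) ⟩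
    h ℤ.- (+ a ℤ.+ + b) ℤ.+ + b                        ≡⟨ shuffle h (+ a) (+ b) ⟩
    (h ℤ.+ + a) ℤ.- (+ a ℤ.+ + a)                      ≡⟨ cong (ℤ._- (+ a ℤ.+ + a)) ih ⟩
    + (2 * (m + a)) ℤ.- (+ a ℤ.+ + a)                  ≡⟨ cong (λ t → + t ℤ.- (+ a ℤ.+ + a)) (sym (double-+ m a)) ⟩
    + (2 * m) ℤ.+ (+ a ℤ.+ + a) ℤ.- (+ a ℤ.+ + a)      ≡⟨ cancel (+ (2 * m)) (+ a ℤ.+ + a) ⟩
    + (2 * m)                                          ∎
    where
    open ≡-Reasoning
    shuffle : ∀ (x y z : ℤ) → x ℤ.- (y ℤ.+ z) ℤ.+ z ≡ (x ℤ.+ y) ℤ.- (y ℤ.+ y)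
    shuffle = solve-∀
    cancel : ∀ (x y : ℤ) → x ℤ.+ y ℤ.- y ≡ x
    cancel = solve-∀
    double-+ : ∀ m a → 2 * m + (a + a) ≡ 2 * (m + a)
    double-+ = ℕ-Solver.solve-∀

module _ {n : ℕ} {σ : Perm n} (dperm : IsDPerm σ) where

  height+parity≡2*fcount : ∀ k → k ≤ 2 * n → height σ k ℤ.+ + bit (odd k) ≡ + (2 * fcount σ k)
  height+parity≡2*fcount zero    _      = refl
  height+parity≡2*fcount (suc k) 1+k≤2n with odd (appInv σ (suc k)) in odd-J
  ... | false = begin
    height σ k ℤ.+ + 1 ℤ.+ + bit (odd (suc k))
      ≡⟨ rise-invariant (height σ k) {m = fcount σ k} (bit-odd-suc k) (height+parity≡2*fcount k (<⇒≤ 1+k≤2n)) ⟩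
    + (2 * (fcount σ k + bit (odd (suc k))))
      ≡⟨ cong (λ f → + (2 * f)) (sym (fcount-rise dperm 1+k≤2n odd-J)) ⟩
    + (2 * fcount σ (suc k)) ∎
    where open ≡-Reasoning
  ... | true = begin
    height σ k ℤ.+ -1ℤ ℤ.+ + bit (odd (suc k))
      ≡⟨ fall-invariant (height σ k) {m = fcount σ (suc k)} (bit-odd-suc k)
           (trans (height+parity≡2*fcount k (<⇒≤ 1+k≤2n)) (cong (λ f → + (2 * f)) (sym (fcount-fall dperm 1+k≤2n odd-J)))) ⟩
    + (2 * fcount σ (suc k)) ∎
    where open ≡-Reasoning

  height-at-even : ∀ {k} → k ≤ 2 * n → odd k ≡ false → height σ k ≡ + (2 * fcount σ k)
  height-at-even {k} k≤2n even-k =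
    trans (sym (ℤ.+-identityʳ _))
          (subst (λ b → height σ k ℤ.+ + bit b ≡ + (2 * fcount σ k)) even-k (height+parity≡2*fcount k k≤2n))

  height-at-odd : ∀ {k} → k ≤ 2 * n → odd k ≡ true → height σ k ℤ.+ + 1 ≡ + (2 * fcount σ k)
  height-at-odd {k} k≤2n odd-k =
    subst (λ b → height σ k ℤ.+ + bit b ≡ + (2 * fcount σ k)) odd-k (height+parity≡2*fcount k k≤2n)

Unique-map⁺-on : ∀ {a b} {A : Set a} {B : Set b} {f : A → B} {xs : List A} →
  (∀ {x y} → x ∈ xs → y ∈ xs → f x ≡ f y → x ≡ y) → Unique xs → Unique (map f xs)
Unique-map⁺-on {xs = []}     inj []             = []
Unique-map⁺-on {xs = x ∷ xs} inj (x∉xs ∷ uxs) =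
  All.map⁺ (All.tabulate (λ y∈ fx≡fy → All.lookup x∉xs y∈ (inj (here refl) (there y∈) fx≡fy)))
  ∷ Unique-map⁺-on (λ x∈ y∈ → inj (there x∈) (there y∈)) uxs

length-unique-⇔ : ∀ {a} {A : Set a} {xs ys : List A} → Unique xs → Unique ys →
  (∀ {z} → z ∈ xs ⇔ z ∈ ys) → length xs ≡ length ys
length-unique-⇔ uxs uys xs⇔ys = ↭-length (∼bag⇒↭ (unique∧set⇒bag uxs uys xs⇔ys))

module _ {n : ℕ} (σ : Perm n) (y : ℕ) where

  ∈-excluded⁻ : ∀ {u} → u ∈ excluded σ y → ∃[ j ] (y + 2 ≤ j × j ≤ 2 * n) × u ≡ app σ j
  ∈-excluded⁻ u∈ with ∈-map⁻ (app σ) u∈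
  ... | j , j∈ , u≡σj with Equivalence.to ∈-range (proj₁ (∈-filter⁻ (λ j → odd j Bool.≟ true) j∈))
  ... | y+2≤j , j≤2n∸1 = j , (y+2≤j , ≤-trans j≤2n∸1 (m∸n≤m (2 * n) 1)) , u≡σj

  ∈-excluded⁺ : ∀ {j} → y + 2 ≤ j → j < 2 * n → odd j ≡ true → app σ j ∈ excluded σ y
  ∈-excluded⁺ y+2≤j j<2n odd-j =
    ∈-map⁺ (app σ) (∈-filter⁺ (λ j → odd j Bool.≟ true) (Equivalence.from ∈-range (y+2≤j , <⇒≤∸1 j<2n)) odd-j)

module _ {n : ℕ} {σ : Perm n} (dperm : IsDPerm σ) {y : ℕ} (y≤2n : y ≤ 2 * n) (odd-y : odd y ≡ true) where

  private
    exceeds? : (i : ℕ) → Dec (y < app σ i)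
    exceeds? i = y <? app σ i
    left? : (u : ℕ) → Dec ((odd (appInv σ u) ≡ true × u ∉ excluded σ y) × y < u)
    left? u = ((odd (appInv σ u) Bool.≟ true) ×-dec ¬? (u ∈? excluded σ y)) ×-dec (y <? u)
    exceeding = filter exceeds? (range 1 y)
    left = filter left? (range 1 (2 * n))

    ∈exceeding⁻ : ∀ {i} → i ∈ exceeding → (1 ≤ i × i ≤ y) × y < app σ i
    ∈exceeding⁻ i∈ = map₁ (Equivalence.to ∈-range) (∈-filter⁻ exceeds? {xs = range 1 y} i∈)

    ∈left⁻ : ∀ {u} → u ∈ left → (1 ≤ u × u ≤ 2 * n) × (odd (appInv σ u) ≡ true × u ∉ excluded σ y) × y < u
    ∈left⁻ u∈ = map₁ (Equivalence.to ∈-range) (∈-filter⁻ left? {xs = range 1 (2 * n)} u∈)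

    ∈exceeding⇒bounded : ∀ {i} → i ∈ exceeding → 1 ≤ i × i ≤ 2 * n
    ∈exceeding⇒bounded i∈ with ∈exceeding⁻ i∈
    ... | (1≤i , i≤y) , _ = 1≤i , ≤-trans i≤y y≤2n

    image⇒left : ∀ {u} → u ∈ map (app σ) exceeding → u ∈ left
    image⇒left u∈ with ∈-map⁻ (app σ) u∈
    ... | i , i∈ , refl with ∈exceeding⁻ i∈
    ... | (1≤i , i≤y) , y<σi =
      ∈-filter⁺ left? (Equivalence.from ∈-range (app-bounded σ 1≤i i≤2n)) ((odd-σ⁻¹σi , σi∉excluded) , y<σi)
      where
      i≤2n = ≤-trans i≤y y≤2n
      odd-σ⁻¹σi : odd (appInv σ (app σ i)) ≡ true
      odd-σ⁻¹σi = subst (λ j → odd j ≡ true) (sym (appInv-app σ 1≤i i≤2n))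
                        (<app⇒odd dperm 1≤i i≤2n (≤-<-trans i≤y y<σi))
      σi∉excluded : app σ i ∉ excluded σ y
      σi∉excluded σi∈ with ∈-excluded⁻ σ y σi∈
      ... | j , (y+2≤j , j≤2n) , σi≡σj = <⇒≱ y<j (subst (_≤ y) i≡j i≤y)
        where
        y<j : y < j
        y<j = <-≤-trans (m<m+n y z<s) y+2≤j
        i≡j : i ≡ j
        i≡j = app-injective σ 1≤i i≤2n (≤-trans (s≤s z≤n) y<j) j≤2n σi≡σj

    left⇒image : ∀ {u} → u ∈ left → u ∈ map (app σ) exceeding
    left⇒image {u} u∈ with ∈left⁻ u∈
    ... | (1≤u , u≤2n) , (odd-j , u∉excluded) , y<u =
      subst (_∈ map (app σ) exceeding) σj≡u
        (∈-map⁺ (app σ) (∈-filter⁺ exceeds? (Equivalence.from ∈-range (1≤j , j≤y)) (subst (y <_) (sym σj≡u) y<u)))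
      where
      j = appInv σ u
      1≤j = proj₁ (appInv-bounded σ 1≤u u≤2n)
      j≤2n = proj₂ (appInv-bounded σ 1≤u u≤2n)
      σj≡u : app σ j ≡ u
      σj≡u = app-appInv σ 1≤u u≤2n
      j≤y : j ≤ y
      j≤y with j ≤? y
      ... | yes j≤y = j≤y
      ... | no  j≰y = contradiction (subst (_∈ excluded σ y) σj≡u (∈-excluded⁺ σ y y+2≤j j<2n odd-j)) u∉excluded
        where
        y+2≤j : y + 2 ≤ j
        y+2≤j = subst (_≤ j) (+-comm 2 y)
          (≤∧≢⇒< (≰⇒> j≰y) (λ 1+y≡j → odd≢even odd-j (trans (odd-suc y) (cong not odd-y)) (sym 1+y≡j)))
        j<2n : j < 2 * n
        j<2n = ≤∧≢⇒< j≤2n (odd≢even odd-j (odd-double n))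

  leftCount≡fcount : leftCount σ y ≡ fcount σ y
  leftCount≡fcount = begin
    leftCount σ y                     ≡⟨ sym (length-unique-⇔ unique-image unique-left (mk⇔ image⇒left left⇒image)) ⟩
    length (map (app σ) exceeding)    ≡⟨ length-map (app σ) exceeding ⟩
    fcount σ y                        ∎
    where
    open ≡-Reasoning
    unique-image : Unique (map (app σ) exceeding)
    unique-image = Unique-map⁺-on
      (λ i∈ j∈ → app-injective σ (proj₁ (∈exceeding⇒bounded i∈)) (proj₂ (∈exceeding⇒bounded i∈))
                                 (proj₁ (∈exceeding⇒bounded j∈)) (proj₂ (∈exceeding⇒bounded j∈)))
      (Unique.filter⁺ exceeds? (range-unique 1 y))
    unique-left : Unique left
    unique-left = Unique.filter⁺ left? (range-unique 1 (2 * n))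

ceilHalf-double : ∀ m → ceilHalf (+ (2 * m)) ≡ + m
ceilHalf-double m = cong +_ (begin
  suc (2 * m) / 2          ≡⟨ cong (λ t → suc t / 2) (*-comm 2 m) ⟩
  (1 + m * 2) / 2          ≡⟨ +-distrib-/-∣ʳ 1 {m * 2} {2} (divides m refl) ⟩
  1 / 2 + m * 2 / 2        ≡⟨ m*n/n≡m m 2 ⟩
  m                        ∎)
  where open ≡-Reasoning

lemma7p7 : (n : ℕ) (σ : Perm n) → IsDPerm σ →
    (y : ℕ) → 1 ≤ y → y ≤ 2 Data.Nat.* n → Odd y → Even (appInv σ y) →
    ((+ leftCount σ y) ≡ ceilHalf (height σ (y Data.Nat.∸ 1)) ℤ.+ + 1)
    × (ceilHalf (height σ (y Data.Nat.∸ 1)) ℤ.+ + 1 ≡ ceilHalf (height σ y ℤ.+ + 1))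
    × (ceilHalf (height σ y ℤ.+ + 1) ≡ + fcount σ y)
lemma7p7 n σ dperm (suc y) _ 1+y≤2n odd-1+y even-σ⁻¹[1+y] =
  trans (cong +_ (leftCount≡fcount dperm 1+y≤2n odd-1+y)) (sym before) , trans before (sym after) , after
  where
  open ≡-Reasoning
  height-y : height σ y ≡ + (2 * fcount σ y)
  height-y = height-at-even dperm (<⇒≤ 1+y≤2n) (odd-suc⁻ {y} odd-1+y)
  f-rises : fcount σ (suc y) ≡ fcount σ y + 1
  f-rises = subst (λ b → fcount σ (suc y) ≡ fcount σ y + bit b) odd-1+y
                  (fcount-rise dperm 1+y≤2n (Even⇒odd≡false {appInv σ (suc y)} even-σ⁻¹[1+y]))
  before : ceilHalf (height σ y) ℤ.+ + 1 ≡ + fcount σ (suc y)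
  before = begin
    ceilHalf (height σ y) ℤ.+ + 1              ≡⟨ cong (λ h → ceilHalf h ℤ.+ + 1) height-y ⟩
    ceilHalf (+ (2 * fcount σ y)) ℤ.+ + 1      ≡⟨ cong (ℤ._+ + 1) (ceilHalf-double (fcount σ y)) ⟩
    + (fcount σ y + 1)                         ≡⟨ cong +_ (sym f-rises) ⟩
    + fcount σ (suc y)                         ∎
  after : ceilHalf (height σ (suc y) ℤ.+ + 1) ≡ + fcount σ (suc y)
  after = trans (cong ceilHalf (height-at-odd dperm 1+y≤2n odd-1+y)) (ceilHalf-double (fcount σ (suc y)))
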